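{- Let $G$ be a binary quasigroup of order $n$ and fix $a,j\in\mathcal I_n$. Then every unit contains at least one of the tuples $\mathbf a_j(b)$, $b\in\mathcal I_n$. Moreover, for each equivalence class, all units of that class contain the same number of tuples of the form $\mathbf a_j(b)$, $b\in\mathcal I_n$.
   Context: Let $\mathcal I_n=\{1,\dots,n\}$. A binary quasigroup $G$ of order $n$ is the set $\mathcal I_n$ with an operation $*$ such that for all $a_0,a_1,a_2$ there are unique $x_1,x_2$ with $a_1*x_2=a_0$ and $x_1*a_2=a_0$. Elements of $\mathcal I_n^n$ are tuples; $*$ acts on tuples entrywise. A permutation is a tuple with pairwise distinct entries; $\mathcal W$ is the set of permutations. For $d\ge0$, a $U$-diagonal of type $V$ in $G[d]$ is a sequence $(W_1,\dots,W_d)\in\mathcal W^d$ with $(\cdots((U*W_1)*W_2)*\cdots)*W_d=V$ entrywise. Tuples $U,V$ are equivalent if for some $d\ge0$ there is a $U$-diagonal of type $V$ in $G[d]$; the classes of this equivalence relation are the equivalence classes. The period $\tau$ of a class $\mathcal U$ is the gcd of all $d\ge1$ such that some $U\in\mathcal U$ admits a $U$-diagonal of type $U$ in $G[d]$. A class of period $\tau$ is partitioned into $\tau$ sets $\mathcal Y_1,\dots,\mathcal Y_\tau$, called units, such that for $U\in\mathcal Y_k$, $V\in\mathcal Y_l$, a $U$-diagonal of type $V$ in $G[d]$ exists only if $l-k\equiv d\pmod\tau$. The tuple $\mathbf a_j(b)$ has all entries equal to $a$ except the $j$-th, which equals $b$ (possibly $b=a$). -}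

module Defs where

open import Data.Nat as ℕ using (ℕ; zero; suc; _≤_)
open import Data.Nat.Divisibility as ℕD using ()
open import Data.Integer as ℤ using (ℤ; +_)
open import Data.Integer.Divisibility as ℤD using ()
open import Data.Fin using (Fin; toℕ)
open import Data.Vec using (Vec; lookup; zipWith; replicate; foldl; _[_]≔_)
open import Data.Vec.Relation.Unary.Unique.Propositional using (Unique)
open import Data.Vec.Membership.Propositional using (_∈_)
open import Data.Product using (Σ; ∃; _×_; proj₁)
open import Relation.Binary.PropositionalEquality using (_≡_)
open import Function.Bundles using (_⇔_)

record Quasigroup (n : ℕ) : Set where
  field
    _∙_ : Fin n → Fin n → Fin n
    left-solve  : ∀ a₀ a₁ → Σ (Fin n) λ x₂ → (a₁ ∙ x₂ ≡ a₀) × (∀ y → a₁ ∙ y ≡ a₀ → y ≡ x₂)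
    right-solve : ∀ a₀ a₂ → Σ (Fin n) λ x₁ → (x₁ ∙ a₂ ≡ a₀) × (∀ y → y ∙ a₂ ≡ a₀ → y ≡ x₁)

module _ {n : ℕ} (G : Quasigroup n) where
  open Quasigroup G

  Tuple : Set
  Tuple = Vec (Fin n) n

  _⊛_ : Tuple → Tuple → Tuple
  U ⊛ W = zipWith _∙_ U W

  IsPerm : Tuple → Set
  IsPerm W = ∀ i k → lookup W i ≡ lookup W k → i ≡ k

  Perm : Set
  Perm = Σ Tuple IsPerm

  -- a U-diagonal of type V in G[d]: (W_1,...,W_d) with (((U*W_1)*W_2)*...)*W_d = V
  Diagonal : Tuple → Tuple → ℕ → Set
  Diagonal U V d = Σ (Vec Perm d) λ Ws → foldl (λ _ → Tuple) (λ X W → X ⊛ proj₁ W) U Ws ≡ V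

  Equivalent : Tuple → Tuple → Set
  Equivalent U V = ∃ λ d → Diagonal U V d

  InClass : Tuple → Tuple → Set
  InClass U₀ U = Equivalent U₀ U

  -- τ is the period of the class of U₀: gcd of all d ≥ 1 such that some U in the
  -- class admits a U-diagonal of type U in G[d]
  ClosedLength : Tuple → ℕ → Set
  ClosedLength U₀ d = 1 ≤ d × ∃ λ U → InClass U₀ U × Diagonal U U d

  IsPeriod : Tuple → ℕ → Set
  IsPeriod U₀ τ = (∀ d → ClosedLength U₀ d → τ ℕD.∣ d)
                × (∀ m → (∀ d → ClosedLength U₀ d → m ℕD.∣ d) → m ℕD.∣ τ)

  CongMod : ℕ → ℤ → ℤ → Set
  CongMod τ x y = (+ τ) ℤD.∣ (x ℤ.- y)

  -- a partition of the class of U₀ into τ units Y_0,...,Y_{τ-1} (U ∈ Y_k iff lab U ≡ k),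
  -- such that a U-diagonal of type V in G[d] with U ∈ Y_k, V ∈ Y_l exists only if l - k ≡ d (mod τ)
  IsUnitLabelling : Tuple → (τ : ℕ) → (Tuple → Fin τ) → Set
  IsUnitLabelling U₀ τ lab =
    ∀ U V d → InClass U₀ U → InClass U₀ V → Diagonal U V d →
      CongMod τ ((+ toℕ (lab V)) ℤ.- (+ toℕ (lab U))) (+ d)

  InUnit : Tuple → (τ : ℕ) → (Tuple → Fin τ) → Fin τ → Tuple → Set
  InUnit U₀ τ lab k U = InClass U₀ U × lab U ≡ k

aj : {n : ℕ} → Fin n → Fin n → Fin n → Vec (Fin n) n
aj {n} a j b = replicate n a [ j ]≔ b

-- Inside a unit, a tuple U = (U / W) * W may be replaced by (U / W) * W′ for any permutation W′,
-- since both lie one diagonal step after U / W. Taking for W′ the permutation W with its entries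
-- at p and j exchanged, and W suitably, turns the entry at any position p ≠ j into a while changing
-- only the j-th entry, and that one injectively. Hence every tuple shares its unit with an axis
-- tuple aj a j b. One step by the identity permutation followed by this normalisation sends
-- aj a j b to an axis tuple aj a j (σ b) of the next unit, with σ injective, so iterating σ from
-- the axis tuple of the unit of U₀ meets every unit, and σ ^ t maps the axis tuples of unit 0
-- bijectively onto those of unit t. Counting them requires membership in a unit to be decidable;
-- it is, because erasing loops shortens every diagonal to length below n ^ n.

module Submission where

open import Defs
open import Data.Nat using (ℕ)
open import Data.Fin using (Fin)
open import Data.Vec using (Vec)
open import Data.Vec.Relation.Unary.Unique.Propositional using (Unique)
open import Data.Vec.Membership.Propositional using (_∈_)
open import Data.Product using (Σ; ∃; _×_)
open import Function.Bundles using (_⇔_)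

open import Level using (0ℓ)
open import Data.Nat using (zero; suc; _+_; _∸_; _^_; _<_)
import Data.Nat.Properties as ℕₚ
import Data.Nat.Divisibility as ℕ∣
open import Data.Integer as ℤ using (ℤ; +_)
import Data.Integer.Properties as ℤₚ
open import Data.Integer.Divisibility.Signed using (_∣_; divides; ∣-refl; ∣⇒∣ᵤ; ∣ᵤ⇒∣; ∣m⇒∣-m; ∣m∣n⇒∣m+n)
open import Data.Integer.Tactic.RingSolver using (solve-∀)
open import Data.Nat.GeneralisedArithmetic using (iterate)
open import Data.Fin as Fin using (toℕ; fromℕ<; punchOut; funToFin; finToFun)
import Data.Fin.Properties as Finₚ
import Data.Fin.Permutation.Components as PC
open import Data.Fin.Permutation as Perm using (Permutation′; _⟨$⟩ʳ_; _∘ₚ_)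
open import Data.List as List using (List)
open import Data.List.Relation.Unary.Any using (here; there)
import Data.List.Relation.Unary.Unique.Propositional as Listᵘ
import Data.List.Relation.Unary.Unique.Propositional.Properties as Listᵘₚ
open import Data.List.Membership.Propositional using () renaming (_∈_ to _∈ₗ_)
import Data.List.Membership.Propositional.Properties as List∈ₚ
import Data.List.Relation.Unary.All.Properties as ListAllₚ
open import Data.List.Relation.Unary.AllPairs using ([]; _∷_)
open import Data.Vec.Relation.Unary.AllPairs using ([]; _∷_)
open import Data.Vec.Relation.Unary.All using (All; []; _∷_)
open import Data.Vec as Vec using ([]; _∷_; lookup; tabulate; zipWith; replicate; foldl)
import Data.Vec.Properties as Vecₚ
import Data.Vec.Relation.Unary.Unique.Propositional.Properties as Uniqueₚ
import Data.Vec.Relation.Unary.All.Properties as Allₚ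
import Data.Vec.Relation.Unary.Any.Properties as Anyₚ
open import Data.Vec.Relation.Unary.Any using (here; there)
open import Data.Vec.Membership.Propositional.Properties
  using (fromAny; ∈-map⁺; ∈-fromList⁺; ∈-fromList⁻; ∈-toList⁻)
open import Data.Vec.Relation.Binary.Pointwise.Extensional using (ext; Pointwise-≡⇒≡)
open import Data.Product using (_,_; proj₁; proj₂)
open import Function using (_∘_; id; Injective)
open import Function.Bundles using (mk⇔; Equivalence; Injection)
open import Function.Properties.Inverse using (↔⇒↣)
open import Relation.Binary.PropositionalEquality
open import Relation.Nullary using (Dec; yes; no; contradiction)
open import Relation.Nullary.Decidable using (map′; dec-true; dec-false; _×-dec_; _→-dec_)
open import Relation.Unary using (Decidable)
import Algebra.Bundles as Alg
import Algebra.Properties.Quasigroup as QuasigroupProperties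

injective⇒surjective : ∀ {m} {f : Fin m → Fin m} → Injective _≡_ _≡_ f → ∀ y → ∃ λ x → f x ≡ y
injective⇒surjective {suc m} {f} f-inj y with Finₚ.any? (λ x → f x Finₚ.≟ y)
... | yes found = found
... | no missed = contradiction (Finₚ.injective⇒≤ g-inj) ℕₚ.1+n≰n
  where
  y≢f : ∀ x → y ≢ f x
  y≢f x y≡fx = missed (x , sym y≡fx)

  g : Fin (suc m) → Fin m
  g x = punchOut (y≢f x)

  g-inj : Injective _≡_ _≡_ g
  g-inj {x} {x′} = f-inj ∘ Finₚ.punchOut-injective (y≢f x) (y≢f x′)

Enumerates : ∀ {A : Set} {c} → (A → Set) → Vec A c → Set
Enumerates P xs = Unique xs × (∀ x → x ∈ xs ⇔ P x)

unique-fromList : ∀ {A : Set} {xs : List A} → Listᵘ.Unique xs → Unique (Vec.fromList xs)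
unique-fromList [] = []
unique-fromList (x∉xs ∷ xs!) = Allₚ.fromList⁺ x∉xs ∷ unique-fromList xs!

enumerate : ∀ {m} {P : Fin m → Set} → Decidable P → ∃ λ c → Σ (Vec (Fin m) c) (Enumerates P)
enumerate {m} {P} P? =
  _ , Vec.fromList xs , unique-fromList (Listᵘₚ.filter⁺ P? (Listᵘₚ.allFin⁺ m)) ,
  λ x → mk⇔ (to x) (from x)
  where
  xs : List (Fin m)
  xs = List.filter P? (List.allFin m)

  to : ∀ x → x ∈ Vec.fromList xs → P x
  to x = proj₂ ∘ List∈ₚ.∈-filter⁻ P? {xs = List.allFin m} ∘ ∈-fromList⁻

  from : ∀ x → P x → x ∈ Vec.fromList xs
  from x = ∈-fromList⁺ ∘ List∈ₚ.∈-filter⁺ P? (List∈ₚ.∈-allFin x)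

map-enumerates : ∀ {A B : Set} {c} {P : A → Set} {Q : B → Set} {f : A → B} {xs : Vec A c} →
                 Injective _≡_ _≡_ f → (∀ y → ∃ λ x → f x ≡ y) → (∀ x → P x ⇔ Q (f x)) →
                 Enumerates P xs → Enumerates Q (Vec.map f xs)
map-enumerates {P = P} {Q} {f} {xs} f-inj f-surj P⇔Q (xs! , ∈⇔P) =
  Uniqueₚ.map⁺ f-inj xs! , λ y → mk⇔ (to y) (from y)
  where
  to : ∀ y → y ∈ Vec.map f xs → Q y
  to y y∈ with x , x∈ , refl ← fromAny (Anyₚ.map⁻ y∈) =
    Equivalence.to (P⇔Q x) (Equivalence.to (∈⇔P x) x∈)

  from : ∀ y → Q y → y ∈ Vec.map f xs
  from y Qy with x , refl ← f-surj y =
    ∈-map⁺ f (Equivalence.from (∈⇔P x) (Equivalence.from (P⇔Q x) Qy))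

module _ {A : Set} {f : A → A} where

  iterate-+ : ∀ x m k → iterate f x (m + k) ≡ iterate f (iterate f x m) k
  iterate-+ x zero k = refl
  iterate-+ x (suc m) k = iterate-+ (f x) m k

  iterate-injective : Injective _≡_ _≡_ f → ∀ k → Injective _≡_ _≡_ (λ x → iterate f x k)
  iterate-injective f-inj zero e = e
  iterate-injective f-inj (suc k) e = f-inj (iterate-injective f-inj k e)

  injective⇒periodic : ∀ {N} {encode : A → Fin N} → Injective _≡_ _≡_ encode →
                       Injective _≡_ _≡_ f → ∀ x → ∃ λ k → iterate f x (suc k) ≡ x
  injective⇒periodic {N} {encode} encode-inj f-inj x
    with i , k , i<k , same ← Finₚ.pigeonhole (ℕₚ.n<1+n N) (λ i → encode (iterate f x (toℕ i))) =
    s , iterate-injective f-inj (toℕ i) (sym (begin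
      iterate f x (toℕ i)                       ≡⟨ encode-inj same ⟩
      iterate f x (toℕ k)                       ≡⟨ cong (iterate f x) k≡s+i ⟩
      iterate f x (suc s + toℕ i)               ≡⟨ iterate-+ x (suc s) (toℕ i) ⟩
      iterate f (iterate f x (suc s)) (toℕ i)   ∎))
    where
    open ≡-Reasoning
    s : ℕ
    s = toℕ k ∸ suc (toℕ i)

    k≡s+i : toℕ k ≡ suc s + toℕ i
    k≡s+i = trans (sym (ℕₚ.m+[n∸m]≡n i<k)) (cong suc (ℕₚ.+-comm (toℕ i) s))

transpose-matchˡ : ∀ {n} (i k : Fin n) → PC.transpose i k i ≡ k
transpose-matchˡ i k rewrite dec-true (i Finₚ.≟ i) refl = refl

transpose-matchʳ : ∀ {n} (i k : Fin n) → PC.transpose i k k ≡ i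
transpose-matchʳ i k with k Finₚ.≟ i
... | yes k≡i = k≡i
... | no _ rewrite dec-true (k Finₚ.≟ k) refl = refl

transpose-noMatch : ∀ {n} {i k x : Fin n} → x ≢ i → x ≢ k → PC.transpose i k x ≡ x
transpose-noMatch {i = i} {k} {x} x≢i x≢k
  rewrite dec-false (x Finₚ.≟ i) x≢i | dec-false (x Finₚ.≟ k) x≢k = refl

permutation-sending : ∀ {n} {p j y z : Fin n} → p ≢ j → y ≢ z →
                      Σ (Permutation′ n) λ π → π ⟨$⟩ʳ p ≡ y × π ⟨$⟩ʳ j ≡ z
permutation-sending {p = p} {j} {y} {z} p≢j y≢z =
  Perm.transpose p y ∘ₚ Perm.transpose j′ z ,
  trans (cong (PC.transpose j′ z) (transpose-matchˡ p y)) (transpose-noMatch y≢j′ y≢z) ,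
  transpose-matchˡ j′ z
  where
  j′ : Fin _
  j′ = PC.transpose p y j

  y≢j′ : y ≢ j′
  y≢j′ y≡j′ = p≢j (Injection.injective (↔⇒↣ (Perm.transpose p y)) (trans (transpose-matchˡ p y) y≡j′))

module _ {n : ℕ} (a j : Fin n) where

  lookup-aj-at : ∀ b → lookup (aj a j b) j ≡ b
  lookup-aj-at b = Vecₚ.lookup∘update j (replicate n a) b

  lookup-aj-off : ∀ {i} b → i ≢ j → lookup (aj a j b) i ≡ a
  lookup-aj-off {i} b i≢j = trans (Vecₚ.lookup∘update′ i≢j (replicate n a) b) (Vecₚ.lookup-replicate i a)

asQuasigroup : ∀ {n} → Quasigroup n → Alg.Quasigroup 0ℓ 0ℓ
asQuasigroup {n} G = record
  { Carrier = Fin n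
  ; _≈_ = _≡_
  ; _∙_ = _∙_
  ; _\\_ = λ x y → proj₁ (left-solve y x)
  ; _//_ = λ y x → proj₁ (right-solve y x)
  ; isQuasigroup = record
    { isMagma = record { isEquivalence = isEquivalence ; ∙-cong = cong₂ _∙_ }
    ; \\-cong = cong₂ _
    ; //-cong = cong₂ _
    ; leftDivides = (λ x y → proj₁ (proj₂ (left-solve y x)))
                  , (λ x y → sym (proj₂ (proj₂ (left-solve (x ∙ y) x)) y refl))
    ; rightDivides = (λ x y → proj₁ (proj₂ (right-solve y x)))
                   , (λ x y → sym (proj₂ (proj₂ (right-solve (y ∙ x) x)) y refl))
    }
  }
  where open Quasigroup G

module TupleDynamics {n : ℕ} (G : Quasigroup n) where
  open import Data.Vec.Membership.DecPropositional {A = Tuple G} (Vecₚ.≡-dec Finₚ._≟_) using (_∈?_)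
  open Quasigroup G
  open Alg.Quasigroup (asQuasigroup G) public using (_\\_; _//_; leftDividesˡ; rightDividesˡ)
  open QuasigroupProperties (asQuasigroup G) public using (cancelʳ; x≈z//y)

  infixl 7 _⊗_
  _⊗_ : Tuple G → Tuple G → Tuple G
  _⊗_ = _⊛_ G

  private variable
    U V X : Tuple G
    d e : ℕ

  lookup-⊗ : ∀ U W i → lookup (U ⊗ W) i ≡ lookup U i ∙ lookup W i
  lookup-⊗ U W i = Vecₚ.lookup-zipWith _∙_ i U W

  ⊗-cancelʳ : ∀ W → Injective _≡_ _≡_ (_⊗ W)
  ⊗-cancelʳ W {U} {V} UW≡VW = Pointwise-≡⇒≡ (ext λ i → cancelʳ (lookup W i) _ _ (begin
    lookup U i ∙ lookup W i   ≡⟨ lookup-⊗ U W i ⟨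
    lookup (U ⊗ W) i          ≡⟨ cong (λ T → lookup T i) UW≡VW ⟩
    lookup (V ⊗ W) i          ≡⟨ lookup-⊗ V W i ⟩
    lookup V i ∙ lookup W i   ∎))
    where open ≡-Reasoning

  toPerm : Permutation′ n → Perm G
  toPerm π = tabulate (π ⟨$⟩ʳ_) , λ i k e → Injection.injective (↔⇒↣ π) (begin
    π ⟨$⟩ʳ i                    ≡⟨ Vecₚ.lookup∘tabulate (π ⟨$⟩ʳ_) i ⟨
    lookup (tabulate (π ⟨$⟩ʳ_)) i ≡⟨ e ⟩
    lookup (tabulate (π ⟨$⟩ʳ_)) k ≡⟨ Vecₚ.lookup∘tabulate (π ⟨$⟩ʳ_) k ⟩
    π ⟨$⟩ʳ k                    ∎)
    where open ≡-Reasoning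

  identityPerm : Perm G
  identityPerm = toPerm Perm.id

  walk : Tuple G → Vec (Perm G) d → Tuple G
  walk = foldl (λ _ → Tuple G) (λ X W → X ⊗ proj₁ W)

  diagonal-∷ : ∀ W → Diagonal G (U ⊗ proj₁ W) V d → Diagonal G U V (suc d)
  diagonal-∷ W (Ws , reaches) = W ∷ Ws , reaches

  diagonal-++ : Diagonal G U V d → Diagonal G V X e → Diagonal G U X (d + e)
  diagonal-++ ([] , refl) D = D
  diagonal-++ (W ∷ Ws , reaches) D = diagonal-∷ W (diagonal-++ (Ws , reaches) D)

  diagonal-step : ∀ U W → Diagonal G U (U ⊗ proj₁ W) 1
  diagonal-step U W = W ∷ [] , refl

  diagonal-iterate : ∀ W k U → Diagonal G U (iterate (_⊗ proj₁ W) U k) k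
  diagonal-iterate W zero U = [] , refl
  diagonal-iterate W (suc k) U = diagonal-∷ W (diagonal-iterate W k (U ⊗ proj₁ W))

  equivalent-refl : Equivalent G U U
  equivalent-refl = 0 , [] , refl

  equivalent-trans : Equivalent G U V → Equivalent G V X → Equivalent G U X
  equivalent-trans (d , D) (e , E) = d + e , diagonal-++ D E

  equivalent-step : ∀ U W → Equivalent G U (U ⊗ proj₁ W)
  equivalent-step U W = 1 , diagonal-step U W

  infixl 7 _⊘_
  _⊘_ : Tuple G → Tuple G → Tuple G
  _⊘_ = zipWith _//_

  ⊘-⊗ : ∀ U W → (U ⊘ W) ⊗ W ≡ U
  ⊘-⊗ U W = Pointwise-≡⇒≡ (ext λ i → begin
    lookup ((U ⊘ W) ⊗ W) i                  ≡⟨ lookup-⊗ (U ⊘ W) W i ⟩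
    lookup (U ⊘ W) i ∙ lookup W i           ≡⟨ cong (_∙ lookup W i) (Vecₚ.lookup-zipWith _//_ i U W) ⟩
    (lookup U i // lookup W i) ∙ lookup W i ≡⟨ rightDividesˡ (lookup W i) (lookup U i) ⟩
    lookup U i                              ∎)
    where open ≡-Reasoning

  //-injective : ∀ z {x x′} → x // z ≡ x′ // z → x ≡ x′
  //-injective z {x} {x′} x/z≡x′/z = begin
    x               ≡⟨ rightDividesˡ z x ⟨
    (x // z) ∙ z    ≡⟨ cong (_∙ z) x/z≡x′/z ⟩
    (x′ // z) ∙ z   ≡⟨ rightDividesˡ z x′ ⟩
    x′              ∎
    where open ≡-Reasoning

  encode : Tuple G → Fin (n ^ n)
  encode U = funToFin (lookup U)

  decode : Fin (n ^ n) → Tuple G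
  decode i = tabulate (finToFun i)

  decode-encode : ∀ U → decode (encode U) ≡ U
  decode-encode U = trans (Vecₚ.tabulate-cong (Finₚ.finToFun-funToFin (lookup U))) (Vecₚ.tabulate∘lookup U)

  encode-injective : Injective _≡_ _≡_ encode
  encode-injective {U} {V} e = trans (sym (decode-encode U)) (trans (cong decode e) (decode-encode V))

  -- Right multiplication by a permutation is injective on the finite set of tuples,
  -- so it returns every tuple to itself after finitely many steps.
  equivalent-stepBack : ∀ U W → Equivalent G (U ⊗ proj₁ W) U
  equivalent-stepBack U W
    with k , cycle ← injective⇒periodic encode-injective (⊗-cancelʳ (proj₁ W)) U =
    k , subst (λ T → Diagonal G (U ⊗ proj₁ W) T k) cycle (diagonal-iterate W k (U ⊗ proj₁ W))

  equivalent-sym : Equivalent G U V → Equivalent G V U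
  equivalent-sym (_ , [] , refl) = equivalent-refl
  equivalent-sym (_ , W ∷ Ws , reaches) =
    equivalent-trans (equivalent-sym (_ , Ws , reaches)) (equivalent-stepBack _ W)

  ∃-tuple? : ∀ {P : Tuple G → Set} → Decidable P → Dec (∃ P)
  ∃-tuple? {P} P? = map′ (λ (i , p) → decode i , p)
                             (λ (U , p) → encode U , subst P (sym (decode-encode U)) p)
                             (Finₚ.any? (P? ∘ decode))

  isPerm? : Decidable (IsPerm G)
  isPerm? W = Finₚ.all? λ i → Finₚ.all? λ k → lookup W i Finₚ.≟ lookup W k →-dec i Finₚ.≟ k

  diagonal? : ∀ d U V → Dec (Diagonal G U V d)
  diagonal? zero U V = map′ ([] ,_) (λ { ([] , U≡V) → U≡V }) (Vecₚ.≡-dec Finₚ._≟_ U V)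
  diagonal? (suc d) U V =
    map′ (λ (W , W-perm , Ws , reaches) → (W , W-perm) ∷ Ws , reaches)
             (λ { ((W , W-perm) ∷ Ws , reaches) → W , W-perm , Ws , reaches })
             (∃-tuple? λ W → isPerm? W ×-dec diagonal? d (U ⊗ W) V)

  trajectory : Tuple G → Vec (Perm G) d → Vec (Tuple G) (suc d)
  trajectory U [] = U ∷ []
  trajectory U (W ∷ Ws) = U ∷ trajectory (U ⊗ proj₁ W) Ws

  SimpleDiagonal : Tuple G → Tuple G → Set
  SimpleDiagonal U V = ∃ λ d → Σ (Vec (Perm G) d) λ Ws → walk U Ws ≡ V × Unique (trajectory U Ws)

  simpleDiagonal-from : ∀ U (Ws : Vec (Perm G) d) → X ∈ trajectory U Ws →
                        Unique (trajectory U Ws) → SimpleDiagonal X (walk U Ws)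
  simpleDiagonal-from U [] (here refl) simple = 0 , [] , refl , simple
  simpleDiagonal-from U (W ∷ Ws) (here refl) simple = _ , W ∷ Ws , refl , simple
  simpleDiagonal-from U (W ∷ Ws) (there X∈) (_ ∷ simple) = simpleDiagonal-from (U ⊗ proj₁ W) Ws X∈ simple

  eraseLoops : ∀ U (Ws : Vec (Perm G) d) → SimpleDiagonal U (walk U Ws)
  eraseLoops U [] = 0 , [] , refl , [] ∷ []
  eraseLoops U (W ∷ Ws) with eraseLoops (U ⊗ proj₁ W) Ws
  ... | d , Ws′ , reaches , simple with U ∈? trajectory (U ⊗ proj₁ W) Ws′
  ...   | yes U∈ = subst (SimpleDiagonal U) reaches (simpleDiagonal-from _ Ws′ U∈ simple)
  ...   | no U∉ = suc d , W ∷ Ws′ , reaches , U∉trajectory ∷ simple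
    where
    U∉trajectory : All (U ≢_) (trajectory (U ⊗ proj₁ W) Ws′)
    U∉trajectory = Allₚ.toList⁻ (ListAllₚ.¬Any⇒All¬ _ (U∉ ∘ ∈-toList⁻))

  simpleDiagonal-short : {Ws : Vec (Perm G) d} → Unique (trajectory U Ws) → d < n ^ n
  simpleDiagonal-short simple =
    Finₚ.injective⇒≤ (λ {i} {k} e → Uniqueₚ.lookup-injective simple i k (encode-injective e))

  shorten : Diagonal G U V d → ∃ λ d′ → d′ < n ^ n × Diagonal G U V d′
  shorten {U} (Ws , refl) with d′ , Ws′ , reaches , simple ← eraseLoops U Ws =
    d′ , simpleDiagonal-short simple , Ws′ , reaches

  equivalent? : ∀ U V → Dec (Equivalent G U V)
  equivalent? U V = map′ (λ (i , D) → toℕ i , D) bounded (Finₚ.any? λ i → diagonal? (toℕ i) U V)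
    where
    bounded : Equivalent G U V → ∃ λ (i : Fin (n ^ n)) → Diagonal G U V (toℕ i)
    bounded (_ , D) with d′ , d′<N , D′ ← shorten D =
      fromℕ< d′<N , subst (Diagonal G U V) (sym (Finₚ.toℕ-fromℕ< d′<N)) D′

∣∧<⇒≡0 : ∀ {m k} → m ℕ∣.∣ k → k < m → k ≡ 0
∣∧<⇒≡0 {k = zero} _ _ = refl
∣∧<⇒≡0 {k = suc k} m∣k k<m = contradiction m∣k (ℕ∣.>⇒∤ k<m)

module Congruence (τ : ℕ) where
  infix 4 _≈_
  record _≈_ (x y : ℤ) : Set where
    constructor mk≈
    field divides-difference : + τ ∣ x ℤ.- y

  private
    variable x y z : ℤ

    negate-difference : ∀ x y → ℤ.- (x ℤ.- y) ≡ y ℤ.- x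
    negate-difference = solve-∀

    telescope : ∀ x y z → (x ℤ.- y) ℤ.+ (y ℤ.- z) ≡ x ℤ.- z
    telescope = solve-∀

    shift-difference : ∀ c x y → (c ℤ.+ x) ℤ.- (c ℤ.+ y) ≡ x ℤ.- y
    shift-difference = solve-∀

    regroup : ∀ x y z → (x ℤ.- y) ℤ.- z ≡ x ℤ.- (z ℤ.+ y)
    regroup = solve-∀

    add-period : ∀ x t → (x ℤ.+ t) ℤ.- x ≡ t
    add-period = solve-∀

  ≈-reflexive : x ≡ y → x ≈ y
  ≈-reflexive {x} refl = mk≈ (divides (+ 0) (ℤₚ.+-inverseʳ x))

  ≈-sym : x ≈ y → y ≈ x
  ≈-sym {x} {y} (mk≈ τ∣x-y) = mk≈ (subst (+ τ ∣_) (negate-difference x y) (∣m⇒∣-m τ∣x-y))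

  ≈-trans : x ≈ y → y ≈ z → x ≈ z
  ≈-trans {x} {y} {z} (mk≈ τ∣x-y) (mk≈ τ∣y-z) =
    mk≈ (subst (+ τ ∣_) (telescope x y z) (∣m∣n⇒∣m+n τ∣x-y τ∣y-z))

  +-congˡ : ∀ c → x ≈ y → c ℤ.+ x ≈ c ℤ.+ y
  +-congˡ {x} {y} c (mk≈ τ∣x-y) = mk≈ (subst (+ τ ∣_) (sym (shift-difference c x y)) τ∣x-y)

  +-cancelˡ : ∀ c → c ℤ.+ x ≈ c ℤ.+ y → x ≈ y
  +-cancelˡ {x} {y} c (mk≈ τ∣difference) = mk≈ (subst (+ τ ∣_) (shift-difference c x y) τ∣difference)

  difference⇒≈ : + τ ∣ (x ℤ.- y) ℤ.- z → x ≈ z ℤ.+ y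
  difference⇒≈ {x} {y} {z} = mk≈ ∘ subst (+ τ ∣_) (regroup x y z)

  +-period : ∀ x → x ℤ.+ + τ ≈ x
  +-period x = mk≈ (subst (+ τ ∣_) (sym (add-period x (+ τ))) ∣-refl)

  ≈⇒≡ : ∀ {u v} → u < τ → v < τ → + u ≈ + v → u ≡ v
  ≈⇒≡ {u} {v} u<τ v<τ (mk≈ τ∣u-v) =
    ℤₚ.+-injective (ℤₚ.i-j≡0⇒i≡j (+ u) (+ v) (ℤₚ.∣i∣≡0⇒i≡0 (∣∧<⇒≡0 (∣⇒∣ᵤ τ∣u-v) distance<τ)))
    where
    distance<τ : ℤ.∣ + u ℤ.- + v ∣ < τ
    distance<τ = subst (_< τ) (cong ℤ.∣_∣ (sym (ℤₚ.[+m]-[+n]≡m⊖n u v)))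
                       (ℕₚ.≤-<-trans (ℤₚ.∣m⊝n∣≤m⊔n u v) (ℕₚ.⊔-lub u<τ v<τ))

module Units {n : ℕ} (G : Quasigroup n) (U₀ : Tuple G) (τ : ℕ) (lab : Tuple G → Fin τ)
             (labelling : IsUnitLabelling G U₀ τ lab) where
  open TupleDynamics G
  open Congruence τ

  private variable
    U V X : Tuple G
    d : ℕ

  label : Tuple G → ℤ
  label U = + toℕ (lab U)

  label-shift : InClass G U₀ U → InClass G U₀ V → Diagonal G U V d → label V ≈ + d ℤ.+ label U
  label-shift {U} {V} {d} U∈ V∈ D = difference⇒≈ {y = label U} {z = + d} (∣ᵤ⇒∣ (labelling U V d U∈ V∈ D))

  lab-unique : ∀ {k} → label U ≈ + toℕ k → lab U ≡ k
  lab-unique {U} {k} = Finₚ.toℕ-injective ∘ ≈⇒≡ (Finₚ.toℕ<n (lab U)) (Finₚ.toℕ<n k)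

  SameUnit : Tuple G → Tuple G → Set
  SameUnit U V = Equivalent G U V × (InClass G U₀ U → lab V ≡ lab U)

  sameUnit-refl : SameUnit U U
  sameUnit-refl = equivalent-refl , λ _ → refl

  sameUnit-trans : SameUnit U V → SameUnit V X → SameUnit U X
  sameUnit-trans (U~V , labV≡) (V~X , labX≡) =
    equivalent-trans U~V V~X , λ U∈ → trans (labX≡ (equivalent-trans U∈ U~V)) (labV≡ U∈)

  sameUnit-siblings : ∀ Y W W′ → SameUnit (Y ⊗ proj₁ W) (Y ⊗ proj₁ W′)
  sameUnit-siblings Y W W′ =
    equivalent-trans (equivalent-stepBack Y W) (equivalent-step Y W′) , same-label
    where
    same-label : InClass G U₀ (Y ⊗ proj₁ W) → lab (Y ⊗ proj₁ W′) ≡ lab (Y ⊗ proj₁ W)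
    same-label YW∈ = lab-unique (≈-trans (label-shift Y∈ YW′∈ (diagonal-step Y W′))
                                         (≈-sym (label-shift Y∈ YW∈ (diagonal-step Y W))))
      where
      Y∈ : InClass G U₀ Y
      Y∈ = equivalent-trans YW∈ (equivalent-stepBack Y W)

      YW′∈ : InClass G U₀ (Y ⊗ proj₁ W′)
      YW′∈ = equivalent-trans Y∈ (equivalent-step Y W′)

module Normalisation {n : ℕ} (G : Quasigroup n) (U₀ : Tuple G) (τ : ℕ) (lab : Tuple G → Fin τ)
            (labelling : IsUnitLabelling G U₀ τ lab) (a j : Fin n) where
  open Quasigroup G
  open TupleDynamics G
  open Congruence τ
  open Units G U₀ τ lab labelling

  AgreeOff : Tuple G → Tuple G → Set
  AgreeOff U V = ∀ i → i ≢ j → lookup U i ≡ lookup V i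

  FibrewiseInjective : (Tuple G → Tuple G) → Set
  FibrewiseInjective f = ∀ U V → AgreeOff U V →
    AgreeOff (f U) (f V) × (lookup (f U) j ≡ lookup (f V) j → lookup U j ≡ lookup V j)

  fibrewiseInjective-∘ : ∀ {f g} → FibrewiseInjective f → FibrewiseInjective g → FibrewiseInjective (g ∘ f)
  fibrewiseInjective-∘ {f} f-inj g-inj U V U≈V with fU≈fV , reflect-f ← f-inj U V U≈V
                                              with gfU≈gfV , reflect-g ← g-inj (f U) (f V) fU≈fV =
    gfU≈gfV , reflect-f ∘ reflect-g

  ⊗-fibrewiseInjective : ∀ W → FibrewiseInjective (_⊗ W)
  ⊗-fibrewiseInjective W U V U≈V =
    (λ i i≢j → trans (lookup-⊗ U W i) (trans (cong (_∙ lookup W i) (U≈V i i≢j)) (sym (lookup-⊗ V W i)))) ,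
    λ e → cancelʳ (lookup W j) _ _ (trans (sym (lookup-⊗ U W j)) (trans e (lookup-⊗ V W j)))

  -- corrected U = (U ⊘ W) ⊗ W′ shares the unit of U = (U ⊘ W) ⊗ W; as W sends p to a \\ c
  -- and j to a \\ a, the entry of corrected U at p is (c // (a \\ c)) ∙ (a \\ a) = a.
  module Correction {p : Fin n} (p≢j : p ≢ j) {c : Fin n} (c≢a : c ≢ a) where
    y≢z : a \\ c ≢ a \\ a
    y≢z y≡z = c≢a (trans (sym (leftDividesˡ a c)) (trans (cong (a ∙_) y≡z) (leftDividesˡ a a)))

    π : Permutation′ n
    π = proj₁ (permutation-sending p≢j y≢z)

    w swap : Fin n → Fin n
    w = π ⟨$⟩ʳ_
    swap = PC.transpose p j

    w-at-p : w p ≡ a \\ c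
    w-at-p = proj₁ (proj₂ (permutation-sending p≢j y≢z))

    w-at-j : w j ≡ a \\ a
    w-at-j = proj₂ (proj₂ (permutation-sending p≢j y≢z))

    W W′ : Perm G
    W = toPerm π
    W′ = toPerm (Perm.transpose p j ∘ₚ π)

    corrected : Tuple G → Tuple G
    corrected U = (U ⊘ proj₁ W) ⊗ proj₁ W′

    corrected-sameUnit : ∀ U → SameUnit U (corrected U)
    corrected-sameUnit U = subst (λ T → SameUnit T (corrected U)) (⊘-⊗ U (proj₁ W))
                                 (sameUnit-siblings (U ⊘ proj₁ W) W W′)

    lookup-corrected : ∀ U i → lookup (corrected U) i ≡ (lookup U i // w i) ∙ w (swap i)
    lookup-corrected U i = trans (lookup-⊗ (U ⊘ proj₁ W) (proj₁ W′) i) (cong₂ _∙_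
      (trans (Vecₚ.lookup-zipWith _//_ i U (proj₁ W)) (cong (lookup U i //_) (Vecₚ.lookup∘tabulate w i)))
      (Vecₚ.lookup∘tabulate (w ∘ swap) i))

    corrected-at : ∀ U → lookup U p ≡ c → lookup (corrected U) p ≡ a
    corrected-at U Up≡c = begin
      lookup (corrected U) p           ≡⟨ lookup-corrected U p ⟩
      (lookup U p // w p) ∙ w (swap p) ≡⟨ cong₂ (λ x k → (x // w p) ∙ w k) Up≡c (transpose-matchˡ p j) ⟩
      (c // w p) ∙ w j                 ≡⟨ cong₂ (λ y z → (c // y) ∙ z) w-at-p w-at-j ⟩
      (c // (a \\ c)) ∙ (a \\ a)       ≡⟨ cong (_∙ (a \\ a)) (x≈z//y a (a \\ c) c (leftDividesˡ a c)) ⟨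
      a ∙ (a \\ a)                     ≡⟨ leftDividesˡ a a ⟩
      a                                ∎
      where open ≡-Reasoning

    corrected-atJ : ∀ U → lookup (corrected U) j ≡ (lookup U j // (a \\ a)) ∙ (a \\ c)
    corrected-atJ U = begin
      lookup (corrected U) j           ≡⟨ lookup-corrected U j ⟩
      (lookup U j // w j) ∙ w (swap j) ≡⟨ cong (λ k → (lookup U j // w j) ∙ w k) (transpose-matchʳ p j) ⟩
      (lookup U j // w j) ∙ w p        ≡⟨ cong₂ (λ z y → (lookup U j // z) ∙ y) w-at-j w-at-p ⟩
      (lookup U j // (a \\ a)) ∙ (a \\ c) ∎
      where open ≡-Reasoning

    corrected-off : ∀ U {i} → i ≢ p → i ≢ j → lookup (corrected U) i ≡ lookup U i
    corrected-off U {i} i≢p i≢j = begin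
      lookup (corrected U) i           ≡⟨ lookup-corrected U i ⟩
      (lookup U i // w i) ∙ w (swap i) ≡⟨ cong (λ k → (lookup U i // w i) ∙ w k) (transpose-noMatch i≢p i≢j) ⟩
      (lookup U i // w i) ∙ w i        ≡⟨ rightDividesˡ (w i) (lookup U i) ⟩
      lookup U i                       ∎
      where open ≡-Reasoning

  correct : Fin n → Tuple G → Tuple G
  correct p U with p Finₚ.≟ j | lookup U p Finₚ.≟ a
  ... | yes _   | _       = U
  ... | no _    | yes _   = U
  ... | no p≢j  | no Up≢a = Correction.corrected p≢j Up≢a U

  correct-sameUnit : ∀ p U → SameUnit U (correct p U)
  correct-sameUnit p U with p Finₚ.≟ j | lookup U p Finₚ.≟ a
  ... | yes _   | _       = sameUnit-refl
  ... | no _    | yes _   = sameUnit-refl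
  ... | no p≢j  | no Up≢a = Correction.corrected-sameUnit p≢j Up≢a U

  correct-at : ∀ {p} U → p ≢ j → lookup (correct p U) p ≡ a
  correct-at {p} U p≢j with p Finₚ.≟ j | lookup U p Finₚ.≟ a
  ... | yes p≡j | _       = contradiction p≡j p≢j
  ... | no _    | yes Up≡a = Up≡a
  ... | no p≢j  | no Up≢a = Correction.corrected-at p≢j Up≢a U refl

  correct-off : ∀ {p i} U → i ≢ p → i ≢ j → lookup (correct p U) i ≡ lookup U i
  correct-off {p} U i≢p i≢j with p Finₚ.≟ j | lookup U p Finₚ.≟ a
  ... | yes _   | _       = refl
  ... | no _    | yes _   = refl
  ... | no p≢j  | no Up≢a = Correction.corrected-off p≢j Up≢a U i≢p i≢j

  correct-fibrewiseInjective : ∀ p → FibrewiseInjective (correct p)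
  correct-fibrewiseInjective p U V U≈V with p Finₚ.≟ j | lookup U p Finₚ.≟ a | lookup V p Finₚ.≟ a
  ... | yes _   | _        | _        = U≈V , id
  ... | no _    | yes _    | yes _    = U≈V , id
  ... | no p≢j  | yes Up≡a | no Vp≢a  = contradiction (trans (sym (U≈V p p≢j)) Up≡a) Vp≢a
  ... | no p≢j  | no Up≢a  | yes Vp≡a = contradiction (trans (U≈V p p≢j) Vp≡a) Up≢a
  ... | no p≢j  | no Up≢a  | no Vp≢a  = agree , reflect
    where
    module CU = Correction p≢j Up≢a
    module CV = Correction p≢j Vp≢a

    agree : AgreeOff (CU.corrected U) (CV.corrected V)
    agree i i≢j with i Finₚ.≟ p
    ... | yes refl = trans (CU.corrected-at U refl) (sym (CV.corrected-at V refl))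
    ... | no i≢p = trans (CU.corrected-off U i≢p i≢j) (trans (U≈V i i≢j) (sym (CV.corrected-off V i≢p i≢j)))

    reflect : lookup (CU.corrected U) j ≡ lookup (CV.corrected V) j → lookup U j ≡ lookup V j
    reflect e = //-injective (a \\ a) (cancelʳ (a \\ lookup U p) _ _ (begin
      (lookup U j // (a \\ a)) ∙ (a \\ lookup U p) ≡⟨ CU.corrected-atJ U ⟨
      lookup (CU.corrected U) j                     ≡⟨ e ⟩
      lookup (CV.corrected V) j                     ≡⟨ CV.corrected-atJ V ⟩
      (lookup V j // (a \\ a)) ∙ (a \\ lookup V p) ≡⟨ cong (λ c → _ ∙ (a \\ c)) (U≈V p p≢j) ⟨
      (lookup V j // (a \\ a)) ∙ (a \\ lookup U p) ∎))
      where open ≡-Reasoning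

  correctAll : List (Fin n) → Tuple G → Tuple G
  correctAll ps U = List.foldr correct U ps

  correctAll-sameUnit : ∀ ps U → SameUnit U (correctAll ps U)
  correctAll-sameUnit List.[] U = sameUnit-refl
  correctAll-sameUnit (p List.∷ ps) U = sameUnit-trans (correctAll-sameUnit ps U) (correct-sameUnit p _)

  correctAll-fibrewiseInjective : ∀ ps → FibrewiseInjective (correctAll ps)
  correctAll-fibrewiseInjective List.[] U V U≈V = U≈V , id
  correctAll-fibrewiseInjective (p List.∷ ps) =
    fibrewiseInjective-∘ {correctAll ps} {correct p}
      (correctAll-fibrewiseInjective ps) (correct-fibrewiseInjective p)

  correctAll-at : ∀ ps U {i} → i ∈ₗ ps → i ≢ j → lookup (correctAll ps U) i ≡ a
  correctAll-at (p List.∷ ps) U (here refl) i≢j = correct-at _ i≢j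
  correctAll-at (p List.∷ ps) U {i} (there i∈ps) i≢j with i Finₚ.≟ p
  ... | yes refl = correct-at _ i≢j
  ... | no i≢p = trans (correct-off _ i≢p i≢j) (correctAll-at ps U i∈ps i≢j)

  normalise : Tuple G → Tuple G
  normalise = correctAll (List.allFin n)

  normalise-sameUnit : ∀ U → SameUnit U (normalise U)
  normalise-sameUnit = correctAll-sameUnit (List.allFin n)

  normalise-axis : ∀ U → normalise U ≡ aj a j (lookup (normalise U) j)
  normalise-axis U = Pointwise-≡⇒≡ (ext entry)
    where
    entry : ∀ i → lookup (normalise U) i ≡ lookup (aj a j (lookup (normalise U) j)) i
    entry i with i Finₚ.≟ j
    ... | yes refl = sym (lookup-aj-at a j _)
    ... | no i≢j = trans (correctAll-at _ U (List∈ₚ.∈-allFin i) i≢j) (sym (lookup-aj-off a j _ i≢j))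

module Axis {n : ℕ} (G : Quasigroup n) (U₀ : Tuple G) (τ : ℕ) (lab : Tuple G → Fin τ)
            (labelling : IsUnitLabelling G U₀ τ lab) (a j : Fin n) where
  open TupleDynamics G
  open Congruence τ
  open Units G U₀ τ lab labelling
  open Normalisation G U₀ τ lab labelling a j

  private variable
    U : Tuple G

  advance : Tuple G → Tuple G
  advance U = normalise (U ⊗ proj₁ identityPerm)

  advance-shift : InClass G U₀ U → InClass G U₀ (advance U) × label (advance U) ≈ + 1 ℤ.+ label U
  advance-shift {U} U∈ with U⊗I~A , lab-preserved ← normalise-sameUnit (U ⊗ proj₁ identityPerm) =
    equivalent-trans U⊗I∈ U⊗I~A ,
    subst (λ k → + toℕ k ≈ + 1 ℤ.+ label U) (sym (lab-preserved U⊗I∈))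
          (label-shift U∈ U⊗I∈ (diagonal-step U identityPerm))
    where
    U⊗I∈ : InClass G U₀ (U ⊗ proj₁ identityPerm)
    U⊗I∈ = equivalent-trans U∈ (equivalent-step U identityPerm)

  advance-reflects : InClass G U₀ (advance U) → InClass G U₀ U
  advance-reflects {U} A∈ = equivalent-trans A∈ (equivalent-sym (equivalent-trans
    (equivalent-step U identityPerm) (proj₁ (normalise-sameUnit (U ⊗ proj₁ identityPerm)))))

  advance-fibrewiseInjective : FibrewiseInjective advance
  advance-fibrewiseInjective =
    fibrewiseInjective-∘ {_⊗ proj₁ identityPerm} {normalise}
      (⊗-fibrewiseInjective (proj₁ identityPerm)) (correctAll-fibrewiseInjective (List.allFin n))

  σ : Fin n → Fin n
  σ b = lookup (advance (aj a j b)) j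

  advance-axis : ∀ b → advance (aj a j b) ≡ aj a j (σ b)
  advance-axis b = normalise-axis _

  σ-injective : Injective _≡_ _≡_ σ
  σ-injective {b} {b′} σb≡σb′ = begin
    b                    ≡⟨ lookup-aj-at a j b ⟨
    lookup (aj a j b) j  ≡⟨ proj₂ (advance-fibrewiseInjective (aj a j b) (aj a j b′) axes-agree) σb≡σb′ ⟩
    lookup (aj a j b′) j ≡⟨ lookup-aj-at a j b′ ⟩
    b′                   ∎
    where
    open ≡-Reasoning
    axes-agree : AgreeOff (aj a j b) (aj a j b′)
    axes-agree i i≢j = trans (lookup-aj-off a j b i≢j) (sym (lookup-aj-off a j b′ i≢j))

  σ-shift : ∀ b → InClass G U₀ (aj a j b) →
    InClass G U₀ (aj a j (σ b)) × label (aj a j (σ b)) ≈ + 1 ℤ.+ label (aj a j b)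
  σ-shift b = subst (λ T → InClass G U₀ T × label T ≈ + 1 ℤ.+ label (aj a j b)) (advance-axis b)
            ∘ advance-shift

  σ-iterate-shift : ∀ t b → InClass G U₀ (aj a j b) →
    InClass G U₀ (aj a j (iterate σ b t)) × label (aj a j (iterate σ b t)) ≈ + t ℤ.+ label (aj a j b)
  σ-iterate-shift zero b b∈ = b∈ , ≈-reflexive (sym (ℤₚ.+-identityˡ _))
  σ-iterate-shift (suc t) b b∈ with σb∈ , σb≈ ← σ-shift b b∈
                               with σᵗσb∈ , σᵗσb≈ ← σ-iterate-shift t (σ b) σb∈ =
    σᵗσb∈ , ≈-trans σᵗσb≈ (≈-trans (+-congˡ (+ t) σb≈) (≈-reflexive (reassociate (+ t) (label (aj a j b)))))
    where
    reassociate : ∀ x l → x ℤ.+ (+ 1 ℤ.+ l) ≡ (+ 1 ℤ.+ x) ℤ.+ l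
    reassociate = solve-∀

  σ-iterate-reflects : ∀ t b → InClass G U₀ (aj a j (iterate σ b t)) → InClass G U₀ (aj a j b)
  σ-iterate-reflects zero b = id
  σ-iterate-reflects (suc t) b =
    advance-reflects ∘ subst (InClass G U₀) (sym (advance-axis b)) ∘ σ-iterate-reflects t (σ b)

  σ-iterate-unit : ∀ t {k k′} → + t ℤ.+ + toℕ k ≈ + toℕ k′ → ∀ b →
    InUnit G U₀ τ lab k (aj a j b) ⇔ InUnit G U₀ τ lab k′ (aj a j (iterate σ b t))
  σ-iterate-unit t {k} {k′} t+k≈k′ b = mk⇔ forward backward
    where
    forward : InUnit G U₀ τ lab k (aj a j b) → InUnit G U₀ τ lab k′ (aj a j (iterate σ b t))
    forward (b∈ , refl) with σᵗb∈ , σᵗb≈ ← σ-iterate-shift t b b∈ = σᵗb∈ , lab-unique (≈-trans σᵗb≈ t+k≈k′)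

    backward : InUnit G U₀ τ lab k′ (aj a j (iterate σ b t)) → InUnit G U₀ τ lab k (aj a j b)
    backward (σᵗb∈ , refl) with b∈ ← σ-iterate-reflects t b σᵗb∈ =
      b∈ , lab-unique (≈-sym (+-cancelˡ (+ t) (≈-trans t+k≈k′ (proj₂ (σ-iterate-shift t b b∈)))))

  every-unit-meets-axis : ∀ k → ∃ λ b → InUnit G U₀ τ lab k (aj a j b)
  every-unit-meets-axis k =
    iterate σ b₀ t ,
    Equivalence.to (σ-iterate-unit t (≈-trans (≈-reflexive (cong +_ t+l₀≡k+τ)) (+-period _)) b₀)
                   (proj₁ b₀-sameUnit , proj₂ b₀-sameUnit equivalent-refl)
    where
    b₀ : Fin n
    b₀ = lookup (normalise U₀) j

    l₀ t : ℕ
    l₀ = toℕ (lab U₀)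
    t = toℕ k + (τ ∸ l₀)

    b₀-sameUnit : SameUnit U₀ (aj a j b₀)
    b₀-sameUnit = subst (SameUnit U₀) (normalise-axis U₀) (normalise-sameUnit U₀)

    t+l₀≡k+τ : t + l₀ ≡ toℕ k + τ
    t+l₀≡k+τ = trans (ℕₚ.+-assoc (toℕ k) (τ ∸ l₀) l₀)
                     (cong (λ x → toℕ k + x) (ℕₚ.m∸n+n≡m (ℕₚ.<⇒≤ (Finₚ.toℕ<n (lab U₀)))))

  inUnit? : ∀ k U → Dec (InUnit G U₀ τ lab k U)
  inUnit? k U = equivalent? U₀ U ×-dec lab U Finₚ.≟ k

proposition2 : {n : ℕ} (G : Quasigroup n) (a j : Fin n) (U₀ : Tuple G) (τ : ℕ)
    (lab : Tuple G → Fin τ) → IsPeriod G U₀ τ → IsUnitLabelling G U₀ τ lab →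
    (∀ k → ∃ λ b → InUnit G U₀ τ lab k (aj a j b))
    × (Σ ℕ λ m → ∀ k → Σ (Vec (Fin n) m) λ bs →
         Unique bs × (∀ b → (b ∈ bs) ⇔ InUnit G U₀ τ lab k (aj a j b)))
proposition2 G a j U₀ zero lab _ labelling = (λ ()) , 0 , λ ()
proposition2 G a j U₀ (suc τ) lab _ labelling =
  let m , axis₀ , axis₀-enumerates = enumerate (λ b → inUnit? Fin.zero (aj a j b)) in
  every-unit-meets-axis , m , λ k →
    Vec.map (λ b → iterate σ b (toℕ k)) axis₀ ,
    map-enumerates (σᵗ-injective k) (injective⇒surjective (σᵗ-injective k))
                   (σ-iterate-unit (toℕ k) (≈-reflexive (cong +_ (ℕₚ.+-identityʳ (toℕ k)))))
                   axis₀-enumerates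
  where
  open Axis G U₀ (suc τ) lab labelling a j
  open Congruence (suc τ) using (≈-reflexive)

  σᵗ-injective : ∀ (k : Fin (suc τ)) → Injective _≡_ _≡_ (λ b → iterate σ b (toℕ k))
  σᵗ-injective k = iterate-injective σ-injective (toℕ k)
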